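{- Let $G$ be a finite group of order $v$ containing a regular $(v,k,\lambda,\mu)$-partial difference set $D$, where $0<\mu<k$ and $\Delta=(\lambda-\mu)^2+4(k-\mu)$ is a perfect square; put $\theta_1=\frac12(\lambda-\mu+\sqrt\Delta)$, $\theta_2=\frac12(\lambda-\mu-\sqrt\Delta)$. If $p$ is a prime and $\ell\ge1$ is such that $p^\ell$ divides both $\theta_1$ and $\theta_2$, then $k\equiv0\pmod{p^\ell}$. In particular, $k\equiv0\pmod{\gcd(\theta_1,\theta_2)}$.
   Context: A subset $D$ of a finite group $G$ of order $v$ with $|D|=k$ is a $(v,k,\lambda,\mu)$-partial difference set if every nonidentity element of $D$ can be written as $xy^{ -1}$ with $x,y\in D$ in exactly $\lambda$ ways, and every nonidentity element of $G\setminus D$ in exactly $\mu$ ways; it is regular if $D=\{d^{ -1}:d\in D\}$ and $1\notin D$. -}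

module Defs where

open import Data.Nat using (ℕ; zero; suc; _+_)
open import Data.Bool using (Bool; true; false; if_then_else_; _∧_)
open import Data.Fin using (Fin; _≟_)
open import Data.Fin.Subset using (Subset; _∈_; _∉_)
open import Data.Vec using (lookup)
open import Data.List using (List; map; allFin)
open import Data.Nat.ListAction using (sum)
open import Data.Product using (_×_)
open import Relation.Nullary using (¬_)
open import Relation.Nullary.Decidable using (⌊_⌋)
open import Relation.Binary.PropositionalEquality using (_≡_)
open import Algebra.Core using (Op₁; Op₂)
open import Algebra.Structures using (IsGroup)

-- A finite group of order v, represented (up to isomorphism) on the carrier Fin v
-- with propositional equality.
record FiniteGroup (v : ℕ) : Set where
  field
    _∙_     : Op₂ (Fin v)
    ε       : Fin v
    _⁻¹     : Op₁ (Fin v)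
    isGroup : IsGroup _≡_ _∙_ ε _⁻¹

module _ {v : ℕ} (G : FiniteGroup v) (D : Subset v) where
  open FiniteGroup G

  ways : Fin v → ℕ
  ways g = sum (map (λ x → sum (map (λ y →
             if lookup D x ∧ lookup D y ∧ ⌊ (x ∙ (y ⁻¹)) ≟ g ⌋ then 1 else 0)
             (allFin v))) (allFin v))

  -- D is a (v, k, lam, mu) partial difference set in G (with k = ∣ D ∣ given separately)
  IsPDS : ℕ → ℕ → Set
  IsPDS lam mu = (g : Fin v) → ¬ (g ≡ ε) →
                 (g ∈ D → ways g ≡ lam) × (g ∉ D → ways g ≡ mu)

  IsRegular : Set
  IsRegular = ((d : Fin v) → d ∈ D → (d ⁻¹) ∈ D) × ε ∉ D

{-# OPTIONS --safe #-}
module Submission where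

-- The Cayley matrix A x y = [x y⁻¹ ∈ D] of a regular partial difference set has constant
-- line sums k, zero diagonal and A² = (k - μ)I + (λ - μ)A + μJ, and θ₁, θ₂ are the roots of
-- x² - (λ - μ)x - (k - μ). The integer matrix N = v(A - θ₂I) - (k - θ₂)J is v(θ₁ - θ₂) times
-- the projection onto the θ₁-eigenspace of A, so N² = v(θ₁ - θ₂)N. An integer matrix with
-- N² = cN has trace divisible by c, and tr N = -v(k + (v - 1)θ₂); hence θ₁ - θ₂ divides
-- k + (v - 1)θ₂ (the quotient is minus the multiplicity of θ₁). So k ∈ θ₁ℤ + θ₂ℤ, and every
-- common divisor of θ₁ and θ₂ divides k.

open import Defs
open import Algebra.Bundles using (Group)
import Algebra.Properties.Group as GroupProperties
open import Data.Bool using (Bool; true; false; if_then_else_; _∧_)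
open import Data.Empty using (⊥-elim)
open import Data.Fin using (Fin; zero; suc; punchIn; _≟_)
open import Data.Fin.Permutation using (permutation)
open import Data.Fin.Properties using (punchInᵢ≢i; all?; ¬∀⟶∃¬)
open import Data.Fin.Subset using (Subset; ∣_∣; _∉_)
open import Data.Integer as ℤ using (ℤ; +_; _-_; _*_; _+_; -_; 0ℤ; 1ℤ; ≢-nonZero)
open import Data.Integer.Divisibility using (_∣_)
open import Data.Integer.Divisibility.Signed as Signed
  using (divides; ∣-reflexive; ∣-trans; ∣m⇒∣-m; ∣m∣n⇒∣m-n; ∣n⇒∣m*n; ∣m+n∣n⇒∣m; *-cancelˡ-∣;
         ∣ᵤ⇒∣; ∣⇒∣ᵤ)
open import Data.Integer.GCD using (gcd; gcd[i,j]∣i; gcd[i,j]∣j)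
open import Data.Integer.Properties
  using (+-*-semiring; pos-+; +-identityˡ; +-identityʳ; *-identityˡ; *-identityʳ; *-zeroˡ; *-zeroʳ;
         *-comm; *-cancelˡ-≡; neg-involutive)
open import Data.Integer.Tactic.RingSolver using (solve-∀)
open import Data.List using (map; tabulate; allFin)
open import Data.List.Properties using (map-tabulate)
open import Data.Nat using (ℕ; zero; suc; _<_; _≤_; _^_)
open import Data.Nat.Divisibility using () renaming (_∣_ to _∣ℕ_)
open import Data.Nat.ListAction using () renaming (sum to sumℕ)
open import Data.Nat.Primality using (Prime)
open import Data.Product using (_×_; _,_; proj₁; proj₂)
open import Data.Vec using ([]; _∷_; lookup)
open import Data.Vec.Properties using ([]=⇒lookup; lookup⇒[]=)
open import Function using (_∘_; id)
open import Relation.Binary.PropositionalEquality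
  using (_≡_; _≢_; refl; sym; trans; cong; cong₂; subst; module ≡-Reasoning)
open import Relation.Nullary using (yes; no)
open import Relation.Nullary.Decidable using (⌊_⌋)

open import Algebra.Properties.Semiring.Sum +-*-semiring
  using (sum; sum-syntax; ∑-distrib-+; ∑-comm; ∑-permute; sum-remove; sum-cong-≗; sum-replicate-zero;
         *-distribˡ-sum; *-distribʳ-sum)

private
  variable
    n : ℕ

indicator : Bool → ℤ
indicator true  = 1ℤ
indicator false = 0ℤ

δ : Fin n → Fin n → ℤ
δ i j = indicator ⌊ i ≟ j ⌋

δ-refl : (i : Fin n) → δ i i ≡ 1ℤ
δ-refl i with i ≟ i
... | yes _   = refl
... | no i≢i = ⊥-elim (i≢i refl)

δ-≢ : {i j : Fin n} → i ≢ j → δ i j ≡ 0ℤ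
δ-≢ {i = i} {j} i≢j with i ≟ j
... | yes i≡j = ⊥-elim (i≢j i≡j)
... | no _    = refl

∑-const : ∀ n (c : ℤ) → ∑[ i < n ] c ≡ + n * c
∑-const zero    c = sym (*-zeroˡ c)
∑-const (suc n) c = trans (cong (_+_ c) (∑-const n c)) (distrib c (+ n))
  where
  distrib : ∀ c m → c + m * c ≡ (1ℤ + m) * c
  distrib = solve-∀

∑-distrib-- : (f g : Fin n → ℤ) → ∑[ i < n ] (f i - g i) ≡ sum f - sum g
∑-distrib-- {zero}  f g = refl
∑-distrib-- {suc n} f g =
  trans (cong (_+_ (f zero - g zero)) (∑-distrib-- (λ i → f (suc i)) (λ i → g (suc i))))
        (regroup (f zero) (g zero) _ _)
  where
  regroup : ∀ a b x y → (a - b) + (x - y) ≡ (a + x) - (b + y)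
  regroup = solve-∀

∑-sub-* : (b : ℤ) (f g : Fin n → ℤ) → ∑[ i < n ] (f i - b * g i) ≡ sum f - b * sum g
∑-sub-* b f g = trans (∑-distrib-- f (λ i → b * g i)) (cong (_-_ (sum f)) (sym (*-distribˡ-sum b g)))

∑-linear : (a b : ℤ) (f g : Fin n → ℤ) →
           ∑[ i < n ] (a * f i - b * g i) ≡ a * sum f - b * sum g
∑-linear a b f g = trans (∑-sub-* b (λ i → a * f i) g) (cong (_- b * sum g) (sym (*-distribˡ-sum a f)))

∑-sift : (i : Fin n) (f : Fin n → ℤ) → (∀ j → j ≢ i → f j ≡ 0ℤ) → sum f ≡ f i
∑-sift {suc n} i f vanishes = begin
  sum f                               ≡⟨ sum-remove {i = i} f ⟩
  f i + ∑[ j < n ] f (punchIn i j)    ≡⟨ cong (_+_ (f i)) rest-vanishes ⟩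
  f i + 0ℤ                            ≡⟨ +-identityʳ (f i) ⟩
  f i                                 ∎
  where
  open ≡-Reasoning
  rest-vanishes : ∑[ j < n ] f (punchIn i j) ≡ 0ℤ
  rest-vanishes = trans (sum-cong-≗ (λ j → vanishes _ (punchInᵢ≢i i j))) (sum-replicate-zero n)

∑-δˡ : (i : Fin n) (f : Fin n → ℤ) → ∑[ j < n ] (δ i j * f j) ≡ f i
∑-δˡ i f = trans (∑-sift i _ (λ j j≢i → trans (cong (_* f j) (δ-≢ (j≢i ∘ sym))) (*-zeroˡ (f j))))
                 (trans (cong (_* f i) (δ-refl i)) (*-identityˡ (f i)))

∑-δʳ : (i : Fin n) (f : Fin n → ℤ) → ∑[ j < n ] (f j * δ j i) ≡ f i
∑-δʳ i f = trans (∑-sift i _ (λ j j≢i → trans (cong (_*_ (f j)) (δ-≢ j≢i)) (*-zeroʳ (f j))))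
                 (trans (cong (_*_ (f i)) (δ-refl i)) (*-identityʳ (f i)))

∑-δ-row : (i : Fin n) → ∑[ j < n ] δ i j ≡ 1ℤ
∑-δ-row i = trans (∑-sift i (δ i) (λ j j≢i → δ-≢ (j≢i ∘ sym))) (δ-refl i)

∑-δ-column : (i : Fin n) → ∑[ j < n ] δ j i ≡ 1ℤ
∑-δ-column i = trans (∑-sift i (λ j → δ j i) (λ j → δ-≢)) (δ-refl i)

Matrix : ℕ → Set
Matrix n = Fin n → Fin n → ℤ

infixl 7 _⋆_

_⋆_ : Matrix n → Matrix n → Matrix n
_⋆_ {n} M P i j = ∑[ m < n ] (M i m * P m j)

tr : Matrix n → ℤ
tr {n} M = ∑[ i < n ] M i i

∑-⋆ : (M P : Matrix n) (i : Fin n) →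
      ∑[ j < n ] (M ⋆ P) i j ≡ ∑[ m < n ] (M i m * ∑[ j < n ] P m j)
∑-⋆ {n} M P i = trans (∑-comm (λ j m → M i m * P m j))
                      (sum-cong-≗ (λ m → sym (*-distribˡ-sum (M i m) (P m))))

minor : Matrix (suc n) → Fin (suc n) → Matrix n
minor M i a b = M (punchIn i a) (punchIn i b)

module _ (M : Matrix (suc n)) (i : Fin (suc n)) (row-zero : ∀ b → M i b ≡ 0ℤ) where

  minor-⋆ : ∀ a b → (minor M i ⋆ minor M i) a b ≡ (M ⋆ M) (punchIn i a) (punchIn i b)
  minor-⋆ a b = sym (begin
    (M ⋆ M) a′ b′                           ≡⟨ sum-remove {i = i} (λ m → M a′ m * M m b′) ⟩
    M a′ i * M i b′ + (minor M i ⋆ minor M i) a b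
      ≡⟨ cong (λ x → M a′ i * x + (minor M i ⋆ minor M i) a b) (row-zero b′) ⟩
    M a′ i * 0ℤ + (minor M i ⋆ minor M i) a b
      ≡⟨ cong (_+ (minor M i ⋆ minor M i) a b) (*-zeroʳ (M a′ i)) ⟩
    0ℤ + (minor M i ⋆ minor M i) a b        ≡⟨ +-identityˡ _ ⟩
    (minor M i ⋆ minor M i) a b             ∎)
    where
    open ≡-Reasoning
    a′ b′ : Fin (suc n)
    a′ = punchIn i a
    b′ = punchIn i b

  tr-minor : tr (minor M i) ≡ tr M
  tr-minor = sym (trans (sum-remove {i = i} (λ m → M m m))
                        (trans (cong (_+ tr (minor M i)) (row-zero i)) (+-identityˡ _)))

module Pivot (N : Matrix n) {c : ℤ} (N⋆N≡cN : ∀ a b → (N ⋆ N) a b ≡ c * N a b) (i : Fin n) where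

  e : ℤ
  e = N i i

  E : Matrix n
  E a b = e * N a b - N a i * N i b

  E-row-zero : ∀ b → E i b ≡ 0ℤ
  E-row-zero b = cancel (N i i) (N i b)
    where
    cancel : ∀ x y → x * y - x * y ≡ 0ℤ
    cancel = solve-∀

  E-column-zero : ∀ a → E a i ≡ 0ℤ
  E-column-zero a = cancel (N i i) (N a i)
    where
    cancel : ∀ x y → x * y - y * x ≡ 0ℤ
    cancel = solve-∀

  E⋆N : ∀ a b → (E ⋆ N) a b ≡ c * E a b
  E⋆N a b = begin
    ∑[ m < n ] (E a m * N m b)
      ≡⟨ sum-cong-≗ (λ m → expand e (N a m) (N a i) (N i m) (N m b)) ⟩
    ∑[ m < n ] (e * (N a m * N m b) - N a i * (N i m * N m b))
      ≡⟨ ∑-linear e (N a i) (λ m → N a m * N m b) (λ m → N i m * N m b) ⟩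
    e * (N ⋆ N) a b - N a i * (N ⋆ N) i b
      ≡⟨ cong₂ (λ x y → e * x - N a i * y) (N⋆N≡cN a b) (N⋆N≡cN i b) ⟩
    e * (c * N a b) - N a i * (c * N i b)
      ≡⟨ factor e c (N a b) (N a i) (N i b) ⟩
    c * E a b ∎
    where
    open ≡-Reasoning
    expand : ∀ e x y z w → (e * x - y * z) * w ≡ e * (x * w) - y * (z * w)
    expand = solve-∀
    factor : ∀ e c x y z → e * (c * x) - y * (c * z) ≡ c * (e * x - y * z)
    factor = solve-∀

  E⋆E : ∀ a b → (E ⋆ E) a b ≡ (e * c) * E a b
  E⋆E a b = begin
    ∑[ m < n ] (E a m * E m b)
      ≡⟨ sum-cong-≗ (λ m → expand e (E a m) (N m b) (N m i) (N i b)) ⟩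
    ∑[ m < n ] (e * (E a m * N m b) - N i b * (E a m * N m i))
      ≡⟨ ∑-linear e (N i b) (λ m → E a m * N m b) (λ m → E a m * N m i) ⟩
    e * (E ⋆ N) a b - N i b * (E ⋆ N) a i
      ≡⟨ cong₂ (λ x y → e * x - N i b * y) (E⋆N a b) (trans (E⋆N a i) (cong (c *_) (E-column-zero a))) ⟩
    e * (c * E a b) - N i b * (c * 0ℤ)
      ≡⟨ factor e c (E a b) (N i b) ⟩
    (e * c) * E a b ∎
    where
    open ≡-Reasoning
    expand : ∀ e g x y z → g * (e * x - y * z) ≡ e * (g * x) - z * (g * y)
    expand = solve-∀
    factor : ∀ e c g z → e * (c * g) - z * (c * 0ℤ) ≡ (e * c) * g
    factor = solve-∀

  tr-E : tr E ≡ e * tr N - c * e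
  tr-E = begin
    ∑[ x < n ] (e * N x x - N x i * N i x)
      ≡⟨ ∑-distrib-- (λ x → e * N x x) (λ x → N x i * N i x) ⟩
    ∑[ x < n ] (e * N x x) - ∑[ x < n ] (N x i * N i x)
      ≡⟨ cong₂ _-_ (*-distribˡ-sum e (λ x → N x x)) (sum-cong-≗ (λ x → *-comm (N i x) (N x i))) ⟨
    e * tr N - (N ⋆ N) i i
      ≡⟨ cong (_-_ (e * tr N)) (N⋆N≡cN i i) ⟩
    e * tr N - c * e ∎
    where
    open ≡-Reasoning

-- Over ℚ, tr N = c · rank N. Over ℤ: a zero diagonal gives trace 0; otherwise eliminate with a
-- nonzero pivot e = N i i, whose minor squares to ec times itself and has trace e tr N - ce.
N⋆N≡cN⇒c∣trN : (N : Matrix n) (c : ℤ) → (∀ a b → (N ⋆ N) a b ≡ c * N a b) → c Signed.∣ tr N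
N⋆N≡cN⇒c∣trN {zero} N c _ = divides 0ℤ (sym (*-zeroˡ c))
N⋆N≡cN⇒c∣trN {suc n} N c N⋆N≡cN with all? (λ i → N i i ℤ.≟ 0ℤ)
... | yes zero-diagonal =
  divides 0ℤ (trans (trans (sum-cong-≗ zero-diagonal) (sum-replicate-zero (suc n))) (sym (*-zeroˡ c)))
... | no ¬zero-diagonal with ¬∀⟶∃¬ _ _ (λ i → N i i ℤ.≟ 0ℤ) ¬zero-diagonal
...   | i , Nii≢0 =
  *-cancelˡ-∣ e {{≢-nonZero Nii≢0}}
    (∣m+n∣n⇒∣m ec∣e·trN-ce (∣m⇒∣-m (∣-reflexive (*-comm e c))))
  where
  open Pivot N {c} N⋆N≡cN i
  ec∣e·trN-ce : e * c Signed.∣ e * tr N - c * e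
  ec∣e·trN-ce = subst (e * c Signed.∣_) (trans (tr-minor E i E-row-zero) tr-E)
    (N⋆N≡cN⇒c∣trN (minor E i) (e * c) (λ a b → trans (minor-⋆ E i E-row-zero a b) (E⋆E _ _)))

record IsStronglyRegular {n : ℕ} (A : Matrix n) (k lam mu : ℤ) : Set where
  field
    rowSum       : ∀ x → ∑[ y < n ] A x y ≡ k
    columnSum    : ∀ y → ∑[ x < n ] A x y ≡ k
    zeroDiagonal : ∀ x → A x x ≡ 0ℤ
    square       : ∀ x y → (A ⋆ A) x y ≡ (k - mu) * δ x y + (lam - mu) * A x y + mu

module StronglyRegular {A : Matrix n} {k lam mu : ℤ} (srg : IsStronglyRegular A k lam mu)
  (θ₁ θ₂ : ℤ) (θ-sum : lam - mu ≡ θ₁ + θ₂) (θ-product : k - mu ≡ - (θ₁ * θ₂)) where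

  open IsStronglyRegular srg
  open ≡-Reasoning

  A-square : ∀ x y → (A ⋆ A) x y ≡ - (θ₁ * θ₂) * δ x y + (θ₁ + θ₂) * A x y + mu
  A-square x y = trans (square x y) (cong₂ (λ p q → p * δ x y + q * A x y + mu) θ-product θ-sum)

  B : Matrix n
  B x y = A x y - θ₂ * δ x y

  B-rowSum : ∀ x → ∑[ y < n ] B x y ≡ k - θ₂
  B-rowSum x = begin
    ∑[ y < n ] (A x y - θ₂ * δ x y)  ≡⟨ ∑-sub-* θ₂ (A x) (δ x) ⟩
    sum (A x) - θ₂ * sum (δ x)       ≡⟨ cong₂ (λ p q → p - θ₂ * q) (rowSum x) (∑-δ-row x) ⟩
    k - θ₂ * 1ℤ                      ≡⟨ cong (_-_ k) (*-identityʳ θ₂) ⟩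
    k - θ₂                           ∎

  B-columnSum : ∀ y → ∑[ x < n ] B x y ≡ k - θ₂
  B-columnSum y = begin
    ∑[ x < n ] (A x y - θ₂ * δ x y)
      ≡⟨ ∑-sub-* θ₂ (λ x → A x y) (λ x → δ x y) ⟩
    ∑[ x < n ] A x y - θ₂ * ∑[ x < n ] δ x y
      ≡⟨ cong₂ (λ p q → p - θ₂ * q) (columnSum y) (∑-δ-column y) ⟩
    k - θ₂ * 1ℤ
      ≡⟨ cong (_-_ k) (*-identityʳ θ₂) ⟩
    k - θ₂ ∎

  A⋆B : ∀ x y → (A ⋆ B) x y ≡ (A ⋆ A) x y - θ₂ * A x y
  A⋆B x y = begin
    ∑[ m < n ] (A x m * (A m y - θ₂ * δ m y))
      ≡⟨ sum-cong-≗ (λ m → expand (A x m) (A m y) θ₂ (δ m y)) ⟩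
    ∑[ m < n ] (A x m * A m y - θ₂ * (A x m * δ m y))
      ≡⟨ ∑-sub-* θ₂ (λ m → A x m * A m y) (λ m → A x m * δ m y) ⟩
    (A ⋆ A) x y - θ₂ * ∑[ m < n ] (A x m * δ m y)
      ≡⟨ cong (λ p → (A ⋆ A) x y - θ₂ * p) (∑-δʳ y (A x)) ⟩
    (A ⋆ A) x y - θ₂ * A x y ∎
    where
    expand : ∀ a b t d → a * (b - t * d) ≡ a * b - t * (a * d)
    expand = solve-∀

  B⋆B : ∀ x y → (B ⋆ B) x y ≡ (A ⋆ B) x y - θ₂ * B x y
  B⋆B x y = begin
    ∑[ m < n ] ((A x m - θ₂ * δ x m) * B m y)
      ≡⟨ sum-cong-≗ (λ m → expand (A x m) θ₂ (δ x m) (B m y)) ⟩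
    ∑[ m < n ] (A x m * B m y - θ₂ * (δ x m * B m y))
      ≡⟨ ∑-sub-* θ₂ (λ m → A x m * B m y) (λ m → δ x m * B m y) ⟩
    (A ⋆ B) x y - θ₂ * ∑[ m < n ] (δ x m * B m y)
      ≡⟨ cong (λ p → (A ⋆ B) x y - θ₂ * p) (∑-δˡ x (λ m → B m y)) ⟩
    (A ⋆ B) x y - θ₂ * B x y ∎
    where
    expand : ∀ a t d b → (a - t * d) * b ≡ a * b - t * (d * b)
    expand = solve-∀

  B-square : ∀ x y → (B ⋆ B) x y ≡ (θ₁ - θ₂) * B x y + mu
  B-square x y = begin
    (B ⋆ B) x y
      ≡⟨ B⋆B x y ⟩
    (A ⋆ B) x y - θ₂ * B x y
      ≡⟨ cong (_- θ₂ * B x y) (A⋆B x y) ⟩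
    (A ⋆ A) x y - θ₂ * A x y - θ₂ * B x y
      ≡⟨ cong (λ p → p - θ₂ * A x y - θ₂ * B x y) (A-square x y) ⟩
    - (θ₁ * θ₂) * δ x y + (θ₁ + θ₂) * A x y + mu - θ₂ * A x y - θ₂ * (A x y - θ₂ * δ x y)
      ≡⟨ collect θ₁ θ₂ (A x y) (δ x y) mu ⟩
    (θ₁ - θ₂) * B x y + mu ∎
    where
    collect : ∀ θ₁ θ₂ a d mu → - (θ₁ * θ₂) * d + (θ₁ + θ₂) * a + mu - θ₂ * a - θ₂ * (a - θ₂ * d)
                             ≡ (θ₁ - θ₂) * (a - θ₂ * d) + mu
    collect = solve-∀

  B⋆B-rowSum : ∀ x → ∑[ y < n ] (B ⋆ B) x y ≡ (k - θ₂) * (k - θ₂)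
  B⋆B-rowSum x = begin
    ∑[ y < n ] (B ⋆ B) x y                 ≡⟨ ∑-⋆ B B x ⟩
    ∑[ m < n ] (B x m * ∑[ y < n ] B m y)  ≡⟨ sum-cong-≗ (λ m → cong (B x m *_) (B-rowSum m)) ⟩
    ∑[ m < n ] (B x m * (k - θ₂))          ≡⟨ *-distribʳ-sum (k - θ₂) (B x) ⟨
    sum (B x) * (k - θ₂)                   ≡⟨ cong (_* (k - θ₂)) (B-rowSum x) ⟩
    (k - θ₂) * (k - θ₂)                    ∎

  nμ≡[k-θ₁][k-θ₂] : Fin n → + n * mu ≡ (k - θ₁) * (k - θ₂)
  nμ≡[k-θ₁][k-θ₂] x = begin
    + n * mu
      ≡⟨ isolate (+ n * mu) ((θ₁ - θ₂) * (k - θ₂)) ⟩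
    (θ₁ - θ₂) * (k - θ₂) + + n * mu - (θ₁ - θ₂) * (k - θ₂)
      ≡⟨ cong (_- (θ₁ - θ₂) * (k - θ₂)) row-sum ⟩
    (k - θ₂) * (k - θ₂) - (θ₁ - θ₂) * (k - θ₂)
      ≡⟨ factor k θ₁ θ₂ ⟩
    (k - θ₁) * (k - θ₂) ∎
    where
    isolate : ∀ w t → w ≡ t + w - t
    isolate = solve-∀
    factor : ∀ k θ₁ θ₂ →
             (k - θ₂) * (k - θ₂) - (θ₁ - θ₂) * (k - θ₂) ≡ (k - θ₁) * (k - θ₂)
    factor = solve-∀
    row-sum : (θ₁ - θ₂) * (k - θ₂) + + n * mu ≡ (k - θ₂) * (k - θ₂)
    row-sum = begin
      (θ₁ - θ₂) * (k - θ₂) + + n * mu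
        ≡⟨ cong₂ _+_ (cong ((θ₁ - θ₂) *_) (B-rowSum x)) (∑-const n mu) ⟨
      (θ₁ - θ₂) * sum (B x) + ∑[ y < n ] mu
        ≡⟨ cong (_+ ∑[ y < n ] mu) (*-distribˡ-sum (θ₁ - θ₂) (B x)) ⟩
      ∑[ y < n ] ((θ₁ - θ₂) * B x y) + ∑[ y < n ] mu
        ≡⟨ ∑-distrib-+ (λ y → (θ₁ - θ₂) * B x y) (λ _ → mu) ⟨
      ∑[ y < n ] ((θ₁ - θ₂) * B x y + mu)
        ≡⟨ sum-cong-≗ (B-square x) ⟨
      ∑[ y < n ] (B ⋆ B) x y
        ≡⟨ B⋆B-rowSum x ⟩
      (k - θ₂) * (k - θ₂) ∎

  N : Matrix n
  N x y = + n * B x y - (k - θ₂)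

  N-rowSum : ∀ x → ∑[ y < n ] N x y ≡ 0ℤ
  N-rowSum x = begin
    ∑[ y < n ] (+ n * B x y - (k - θ₂))
      ≡⟨ ∑-distrib-- (λ y → + n * B x y) (λ _ → k - θ₂) ⟩
    ∑[ y < n ] (+ n * B x y) - ∑[ y < n ] (k - θ₂)
      ≡⟨ cong₂ _-_ (*-distribˡ-sum (+ n) (B x)) (sym (∑-const n (k - θ₂))) ⟨
    + n * sum (B x) - + n * (k - θ₂)
      ≡⟨ cong (λ p → + n * p - + n * (k - θ₂)) (B-rowSum x) ⟩
    + n * (k - θ₂) - + n * (k - θ₂)
      ≡⟨ cancel (+ n * (k - θ₂)) ⟩
    0ℤ ∎
    where
    cancel : ∀ a → a - a ≡ 0ℤ
    cancel = solve-∀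

  N⋆B : ∀ x y → (N ⋆ B) x y ≡ (θ₁ - θ₂) * N x y
  N⋆B x y = begin
    ∑[ m < n ] ((+ n * B x m - (k - θ₂)) * B m y)
      ≡⟨ sum-cong-≗ (λ m → expand (+ n) (B x m) (k - θ₂) (B m y)) ⟩
    ∑[ m < n ] (+ n * (B x m * B m y) - (k - θ₂) * B m y)
      ≡⟨ ∑-linear (+ n) (k - θ₂) (λ m → B x m * B m y) (λ m → B m y) ⟩
    + n * (B ⋆ B) x y - (k - θ₂) * ∑[ m < n ] B m y
      ≡⟨ cong₂ (λ p q → + n * p - (k - θ₂) * q) (B-square x y) (B-columnSum y) ⟩
    + n * ((θ₁ - θ₂) * B x y + mu) - (k - θ₂) * (k - θ₂)
      ≡⟨ separate (+ n) (θ₁ - θ₂) (B x y) mu (k - θ₂) ⟩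
    (θ₁ - θ₂) * (+ n * B x y) + + n * mu - (k - θ₂) * (k - θ₂)
      ≡⟨ cong (λ p → (θ₁ - θ₂) * (+ n * B x y) + p - (k - θ₂) * (k - θ₂))
              (nμ≡[k-θ₁][k-θ₂] x) ⟩
    (θ₁ - θ₂) * (+ n * B x y) + (k - θ₁) * (k - θ₂) - (k - θ₂) * (k - θ₂)
      ≡⟨ collect θ₁ θ₂ (+ n * B x y) k ⟩
    (θ₁ - θ₂) * N x y ∎
    where
    expand : ∀ v b κ c → (v * b - κ) * c ≡ v * (b * c) - κ * c
    expand = solve-∀
    separate : ∀ v s b mu κ → v * (s * b + mu) - κ * κ ≡ s * (v * b) + v * mu - κ * κ
    separate = solve-∀
    collect : ∀ θ₁ θ₂ b k → (θ₁ - θ₂) * b + (k - θ₁) * (k - θ₂) - (k - θ₂) * (k - θ₂)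
                          ≡ (θ₁ - θ₂) * (b - (k - θ₂))
    collect = solve-∀

  N⋆N : ∀ x y → (N ⋆ N) x y ≡ (+ n * (θ₁ - θ₂)) * N x y
  N⋆N x y = begin
    ∑[ m < n ] (N x m * (+ n * B m y - (k - θ₂)))
      ≡⟨ sum-cong-≗ (λ m → expand (+ n) (N x m) (B m y) (k - θ₂)) ⟩
    ∑[ m < n ] (+ n * (N x m * B m y) - (k - θ₂) * N x m)
      ≡⟨ ∑-linear (+ n) (k - θ₂) (λ m → N x m * B m y) (N x) ⟩
    + n * (N ⋆ B) x y - (k - θ₂) * sum (N x)
      ≡⟨ cong₂ (λ p q → + n * p - (k - θ₂) * q) (N⋆B x y) (N-rowSum x) ⟩
    + n * ((θ₁ - θ₂) * N x y) - (k - θ₂) * 0ℤ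
      ≡⟨ collect (+ n) (θ₁ - θ₂) (N x y) (k - θ₂) ⟩
    (+ n * (θ₁ - θ₂)) * N x y ∎
    where
    expand : ∀ v a b κ → a * (v * b - κ) ≡ v * (a * b) - κ * a
    expand = solve-∀
    collect : ∀ v s a κ → v * (s * a) - κ * 0ℤ ≡ (v * s) * a
    collect = solve-∀

  tr-N : tr N ≡ - (+ n * (k + (+ n - 1ℤ) * θ₂))
  tr-N = begin
    ∑[ x < n ] (+ n * (A x x - θ₂ * δ x x) - (k - θ₂))
      ≡⟨ sum-cong-≗ (λ x → cong₂ (λ a d → + n * (a - θ₂ * d) - (k - θ₂))
                                 (zeroDiagonal x) (δ-refl x)) ⟩
    ∑[ x < n ] (+ n * (0ℤ - θ₂ * 1ℤ) - (k - θ₂))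
      ≡⟨ ∑-const n _ ⟩
    + n * (+ n * (0ℤ - θ₂ * 1ℤ) - (k - θ₂))
      ≡⟨ collect (+ n) θ₂ k ⟩
    - (+ n * (k + (+ n - 1ℤ) * θ₂)) ∎
    where
    collect : ∀ v θ k → v * (v * (0ℤ - θ * 1ℤ) - (k - θ)) ≡ - (v * (k + (v - 1ℤ) * θ))
    collect = solve-∀

θ₁-θ₂∣k+[n-1]θ₂ : {A : Matrix n} {k lam mu : ℤ} → IsStronglyRegular A k lam mu → Fin n →
                  (θ₁ θ₂ : ℤ) → lam - mu ≡ θ₁ + θ₂ → k - mu ≡ - (θ₁ * θ₂) →
                  θ₁ - θ₂ Signed.∣ k + (+ n - 1ℤ) * θ₂
θ₁-θ₂∣k+[n-1]θ₂ {suc n} {k = k} srg _ θ₁ θ₂ θ-sum θ-product =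
  *-cancelˡ-∣ (+ suc n) (subst (+ suc n * (θ₁ - θ₂) Signed.∣_) (neg-involutive _)
    (∣m⇒∣-m (subst (+ suc n * (θ₁ - θ₂) Signed.∣_) tr-N (N⋆N≡cN⇒c∣trN N _ N⋆N))))
  where
  open StronglyRegular srg θ₁ θ₂ θ-sum θ-product

+-sum-tabulate : (h : Fin n → ℕ) → + (sumℕ (tabulate h)) ≡ ∑[ i < n ] (+ h i)
+-sum-tabulate {zero}  h = refl
+-sum-tabulate {suc n} h =
  trans (pos-+ (h zero) _) (cong (_+_ (+ h zero)) (+-sum-tabulate (h ∘ suc)))

+-sum-map-allFin : (h : Fin n → ℕ) → + (sumℕ (map h (allFin n))) ≡ ∑[ i < n ] (+ h i)
+-sum-map-allFin h = trans (cong (λ l → + (sumℕ l)) (map-tabulate id h)) (+-sum-tabulate h)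

∑-indicator-lookup : (D : Subset n) → ∑[ x < n ] indicator (lookup D x) ≡ + ∣ D ∣
∑-indicator-lookup []          = refl
∑-indicator-lookup (true  ∷ D) = cong (_+_ 1ℤ) (∑-indicator-lookup D)
∑-indicator-lookup (false ∷ D) = trans (+-identityˡ _) (∑-indicator-lookup D)

indicator-idem : ∀ b → indicator b * indicator b ≡ indicator b
indicator-idem true  = refl
indicator-idem false = refl

+-if-∧ : ∀ a b c → + (if a ∧ b ∧ c then 1 else 0) ≡ indicator a * (indicator b * indicator c)
+-if-∧ true  true  true  = refl
+-if-∧ true  true  false = refl
+-if-∧ true  false c     = refl
+-if-∧ false b     c     = refl

module Cayley {v : ℕ} (G : FiniteGroup v) (D : Subset v) (regular : IsRegular G D) where

  open FiniteGroup G

  group : Group _ _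
  group = record { Carrier = Fin v ; _≈_ = _≡_ ; _∙_ = _∙_ ; ε = ε ; _⁻¹ = _⁻¹ ; isGroup = isGroup }

  open Group group using (_//_; _\\_; assoc; identityˡ; inverseʳ)
  open GroupProperties group
    using (⁻¹-involutive; ⁻¹-anti-homo-//; ⁻¹-anti-homo-\\; \\-leftDividesˡ;
           //-rightDividesˡ; //-rightDividesʳ; x∙y⁻¹≈ε⇒x≈y)
  open ≡-Reasoning

  χ : Fin v → ℤ
  χ x = indicator (lookup D x)

  cayley : Matrix v
  cayley x y = χ (x // y)

  χ-⁻¹ : ∀ x → χ (x ⁻¹) ≡ χ x
  χ-⁻¹ x = cong indicator (lookup-⁻¹ (lookup D x) refl)
    where
    closed : ∀ y → lookup D y ≡ true → lookup D (y ⁻¹) ≡ true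
    closed y y∈D = []=⇒lookup (proj₁ regular y (lookup⇒[]= y D y∈D))
    lookup-⁻¹ : ∀ b → lookup D x ≡ b → lookup D (x ⁻¹) ≡ b
    lookup-⁻¹ true  x∈D = closed x x∈D
    lookup-⁻¹ false x∉D with lookup D (x ⁻¹) in x⁻¹∈?D
    ... | false = refl
    ... | true  = trans (sym (trans (cong (lookup D) (sym (⁻¹-involutive x))) (closed (x ⁻¹) x⁻¹∈?D))) x∉D

  χ-ε : χ ε ≡ 0ℤ
  χ-ε with lookup D ε in ε∈?D
  ... | false = refl
  ... | true  = ⊥-elim (proj₂ regular (lookup⇒[]= ε D ε∈?D))

  cayley-symmetric : ∀ x y → cayley x y ≡ cayley y x
  cayley-symmetric x y = trans (sym (χ-⁻¹ (x // y))) (cong χ (⁻¹-anti-homo-// x y))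

  cayley-columnSum : ∀ y → ∑[ x < v ] cayley x y ≡ + ∣ D ∣
  cayley-columnSum y =
    trans (sym (∑-permute χ (permutation (_// y) (_∙ y) (//-rightDividesʳ y) (//-rightDividesˡ y))))
          (∑-indicator-lookup D)

  cayley-rowSum : ∀ x → ∑[ y < v ] cayley x y ≡ + ∣ D ∣
  cayley-rowSum x = trans (sum-cong-≗ (cayley-symmetric x)) (cayley-columnSum x)

  cayley-zeroDiagonal : ∀ x → cayley x x ≡ 0ℤ
  cayley-zeroDiagonal x = trans (cong χ (inverseʳ x)) χ-ε

  cayley⋆cayley : ∀ a b → (cayley ⋆ cayley) a b ≡ ∑[ y < v ] (χ ((a // b) ∙ y) * χ y)
  cayley⋆cayley a b = begin
    ∑[ m < v ] (χ (a // m) * χ (m // b))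
      ≡⟨ sum-cong-≗ (λ m → cong (χ (a // m) *_) (cayley-symmetric m b)) ⟩
    ∑[ m < v ] (χ (a // m) * χ (b // m))
      ≡⟨ ∑-permute (λ m → χ (a // m) * χ (b // m)) (permutation (_\\ b) (b //_) undo-// undo-\\) ⟩
    ∑[ y < v ] (χ (a // (y \\ b)) * χ (b // (y \\ b)))
      ≡⟨ sum-cong-≗ (λ y → cong₂ (λ p q → χ p * χ q) (a//[y\\b] a y) (undo-\\ y)) ⟩
    ∑[ y < v ] (χ ((a // b) ∙ y) * χ y) ∎
    where
    a//[y\\b] : ∀ a y → a // (y \\ b) ≡ (a // b) ∙ y
    a//[y\\b] a y = trans (cong (a ∙_) (⁻¹-anti-homo-\\ y b)) (sym (assoc a (b ⁻¹) y))
    undo-\\ : ∀ y → b // (y \\ b) ≡ y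
    undo-\\ y = trans (a//[y\\b] b y) (trans (cong (_∙ y) (inverseʳ b)) (identityˡ y))
    undo-// : ∀ m → (b // m) \\ b ≡ m
    undo-// m = trans (cong (_∙ b) (⁻¹-anti-homo-// b m)) (//-rightDividesˡ b m)

  ways≡∑ : ∀ g → + ways G D g ≡ ∑[ y < v ] (χ (g ∙ y) * χ y)
  ways≡∑ g = begin
    + ways G D g
      ≡⟨ trans (+-sum-map-allFin (λ x → sumℕ (map (counted x) (allFin v))))
               (sum-cong-≗ λ x → trans (+-sum-map-allFin (counted x))
                                       (sum-cong-≗ λ y → +-if-∧ (lookup D x) (lookup D y) _)) ⟩
    ∑[ x < v ] ∑[ y < v ] (χ x * (χ y * δ (x // y) g))
      ≡⟨ ∑-comm (λ x y → χ x * (χ y * δ (x // y) g)) ⟩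
    ∑[ y < v ] ∑[ x < v ] (χ x * (χ y * δ (x // y) g))
      ≡⟨ sum-cong-≗ (λ y → ∑-sift (g ∙ y) _ (λ x x≢gy → off-diagonal x y x≢gy)) ⟩
    ∑[ y < v ] (χ (g ∙ y) * (χ y * δ ((g ∙ y) // y) g))
      ≡⟨ sum-cong-≗ (λ y → cong (λ d → χ (g ∙ y) * (χ y * d)) (δ-refl′ y)) ⟩
    ∑[ y < v ] (χ (g ∙ y) * (χ y * 1ℤ))
      ≡⟨ sum-cong-≗ (λ y → cong (χ (g ∙ y) *_) (*-identityʳ (χ y))) ⟩
    ∑[ y < v ] (χ (g ∙ y) * χ y) ∎
    where
    counted : Fin v → Fin v → ℕ
    counted x y = if lookup D x ∧ lookup D y ∧ ⌊ x // y ≟ g ⌋ then 1 else 0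
    off-diagonal : ∀ x y → x ≢ g ∙ y → χ x * (χ y * δ (x // y) g) ≡ 0ℤ
    off-diagonal x y x≢gy = trans (cong (λ d → χ x * (χ y * d)) (δ-≢ λ x//y≡g →
        x≢gy (trans (sym (//-rightDividesˡ y x)) (cong (_∙ y) x//y≡g))))
      (trans (cong (χ x *_) (*-zeroʳ (χ y))) (*-zeroʳ (χ x)))
    δ-refl′ : ∀ y → δ ((g ∙ y) // y) g ≡ 1ℤ
    δ-refl′ y = trans (cong (λ h → δ h g) (//-rightDividesʳ y g)) (δ-refl g)

  pds⇒ways≡ : ∀ {lam mu} → IsPDS G D lam mu →
              ∀ g → g ≢ ε → + ways G D g ≡ (+ lam - + mu) * χ g + + mu
  pds⇒ways≡ {lam} {mu} pds g g≢ε with lookup D g in g∈?D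
  ... | true  = trans (cong +_ (proj₁ (pds g g≢ε) (lookup⇒[]= g D g∈?D))) (through-one (+ lam) (+ mu))
    where
    through-one : ∀ l m → l ≡ (l - m) * 1ℤ + m
    through-one = solve-∀
  ... | false = trans (cong +_ (proj₂ (pds g g≢ε) g∉D)) (through-zero (+ lam) (+ mu))
    where
    g∉D : g ∉ D
    g∉D g∈D with () ← trans (sym ([]=⇒lookup g∈D)) g∈?D
    through-zero : ∀ l m → m ≡ (l - m) * 0ℤ + m
    through-zero = solve-∀

  cayley-square : ∀ {lam mu} → IsPDS G D lam mu → ∀ a b →
    (cayley ⋆ cayley) a b ≡ (+ ∣ D ∣ - + mu) * δ a b + (+ lam - + mu) * cayley a b + + mu
  -- Matching on a ≟ b also evaluates δ a b in the goal, to 1ℤ resp. 0ℤ.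
  cayley-square {lam} {mu} pds a b with a ≟ b
  ... | yes refl = begin
    (cayley ⋆ cayley) a a                  ≡⟨ cayley⋆cayley a a ⟩
    ∑[ y < v ] (χ ((a // a) ∙ y) * χ y)    ≡⟨ sum-cong-≗ (λ y → cong (λ h → χ h * χ y) (ε∙y≡y y)) ⟩
    ∑[ y < v ] (χ y * χ y)                 ≡⟨ sum-cong-≗ (λ y → indicator-idem (lookup D y)) ⟩
    ∑[ y < v ] χ y                         ≡⟨ ∑-indicator-lookup D ⟩
    + ∣ D ∣                                ≡⟨ through-diagonal (+ ∣ D ∣) (+ lam) (+ mu) ⟩
    (+ ∣ D ∣ - + mu) * 1ℤ + (+ lam - + mu) * 0ℤ + + mu
      ≡⟨ cong (λ c → (+ ∣ D ∣ - + mu) * 1ℤ + (+ lam - + mu) * c + + mu) (cayley-zeroDiagonal a) ⟨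
    (+ ∣ D ∣ - + mu) * 1ℤ + (+ lam - + mu) * cayley a a + + mu ∎
    where
    ε∙y≡y : ∀ y → (a // a) ∙ y ≡ y
    ε∙y≡y y = trans (cong (_∙ y) (inverseʳ a)) (identityˡ y)
    through-diagonal : ∀ k l m → k ≡ (k - m) * 1ℤ + (l - m) * 0ℤ + m
    through-diagonal = solve-∀
  ... | no a≢b = begin
    (cayley ⋆ cayley) a b                  ≡⟨ cayley⋆cayley a b ⟩
    ∑[ y < v ] (χ ((a // b) ∙ y) * χ y)    ≡⟨ ways≡∑ (a // b) ⟨
    + ways G D (a // b)                    ≡⟨ pds⇒ways≡ pds (a // b) (a≢b ∘ x∙y⁻¹≈ε⇒x≈y a b) ⟩
    (+ lam - + mu) * cayley a b + + mu     ≡⟨ off-diagonal (+ ∣ D ∣) (+ lam) (+ mu) (cayley a b) ⟩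
    (+ ∣ D ∣ - + mu) * 0ℤ + (+ lam - + mu) * cayley a b + + mu ∎
    where
    off-diagonal : ∀ k l m c → (l - m) * c + m ≡ (k - m) * 0ℤ + (l - m) * c + m
    off-diagonal = solve-∀

  cayley-isStronglyRegular : ∀ {lam mu} → IsPDS G D lam mu →
                             IsStronglyRegular cayley (+ ∣ D ∣) (+ lam) (+ mu)
  cayley-isStronglyRegular pds = record
    { rowSum       = cayley-rowSum
    ; columnSum    = cayley-columnSum
    ; zeroDiagonal = cayley-zeroDiagonal
    ; square       = cayley-square pds
    }

vieta : {L K s θ₁ θ₂ : ℤ} → s * s ≡ L * L + + 4 * K → + 2 * θ₁ ≡ L + s → + 2 * θ₂ ≡ L - s →
        L ≡ θ₁ + θ₂ × K ≡ - (θ₁ * θ₂)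
vieta {L} {K} {s} {θ₁} {θ₂} s²≡Δ 2θ₁≡L+s 2θ₂≡L-s = θ-sum , θ-product
  where
  open ≡-Reasoning
  θ-sum : L ≡ θ₁ + θ₂
  θ-sum = *-cancelˡ-≡ (+ 2) L (θ₁ + θ₂) (begin
    + 2 * L                      ≡⟨ double L s ⟩
    (L + s) + (L - s)            ≡⟨ cong₂ _+_ 2θ₁≡L+s 2θ₂≡L-s ⟨
    + 2 * θ₁ + + 2 * θ₂          ≡⟨ factor θ₁ θ₂ ⟩
    + 2 * (θ₁ + θ₂)              ∎)
    where
    double : ∀ L s → + 2 * L ≡ (L + s) + (L - s)
    double = solve-∀
    factor : ∀ a b → + 2 * a + + 2 * b ≡ + 2 * (a + b)
    factor = solve-∀
  θ-product : K ≡ - (θ₁ * θ₂)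
  θ-product = *-cancelˡ-≡ (+ 4) K (- (θ₁ * θ₂)) (begin
    + 4 * K                      ≡⟨ isolate L K ⟩
    (L * L + + 4 * K) - L * L    ≡⟨ cong (_- L * L) s²≡Δ ⟨
    s * s - L * L                ≡⟨ difference-of-squares L s ⟩
    - ((L + s) * (L - s))        ≡⟨ cong₂ (λ p q → - (p * q)) 2θ₁≡L+s 2θ₂≡L-s ⟨
    - ((+ 2 * θ₁) * (+ 2 * θ₂))  ≡⟨ factor θ₁ θ₂ ⟩
    + 4 * - (θ₁ * θ₂)            ∎)
    where
    isolate : ∀ L K → + 4 * K ≡ (L * L + + 4 * K) - L * L
    isolate = solve-∀
    difference-of-squares : ∀ L s → s * s - L * L ≡ - ((L + s) * (L - s))
    difference-of-squares = solve-∀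
    factor : ∀ a b → - ((+ 2 * a) * (+ 2 * b)) ≡ + 4 * - (a * b)
    factor = solve-∀

lemma4p3 : {v : ℕ} (G : FiniteGroup v) (D : Subset v) (k lam mu : ℕ) →
           ∣ D ∣ ≡ k → IsPDS G D lam mu → IsRegular G D →
           0 < mu → mu < k →
           (s : ℕ) →
           (+ s) * (+ s) ≡ (+ lam - + mu) * (+ lam - + mu) + + 4 * (+ k - + mu) →
           (θ₁ θ₂ : ℤ) →
           + 2 * θ₁ ≡ (+ lam - + mu) + + s →
           + 2 * θ₂ ≡ (+ lam - + mu) - + s →
           ((p ℓ : ℕ) → Prime p → 1 ≤ ℓ →
             (+ (p ^ ℓ)) ∣ θ₁ → (+ (p ^ ℓ)) ∣ θ₂ → (p ^ ℓ) ∣ℕ k)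
           × (gcd θ₁ θ₂ ∣ + k)
lemma4p3 {v} G D k lam mu ∣D∣≡k pds regular _ _ s s²≡Δ θ₁ θ₂ 2θ₁≡ 2θ₂≡ =
  (λ p ℓ _ _ p^ℓ∣θ₁ p^ℓ∣θ₂ → common-divisor∣k (+ (p ^ ℓ)) p^ℓ∣θ₁ p^ℓ∣θ₂) ,
  common-divisor∣k (gcd θ₁ θ₂) (gcd[i,j]∣i θ₁ θ₂) (gcd[i,j]∣j θ₁ θ₂)
  where
  open Cayley G D regular using (cayley; cayley-isStronglyRegular)
  open FiniteGroup G using (ε)
  srg : IsStronglyRegular cayley (+ k) (+ lam) (+ mu)
  srg = subst (λ k → IsStronglyRegular cayley (+ k) (+ lam) (+ mu)) ∣D∣≡k (cayley-isStronglyRegular pds)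
  roots : + lam - + mu ≡ θ₁ + θ₂ × + k - + mu ≡ - (θ₁ * θ₂)
  roots = vieta s²≡Δ 2θ₁≡ 2θ₂≡
  θ₁-θ₂∣k+[v-1]θ₂ : θ₁ - θ₂ Signed.∣ + k + (+ v - 1ℤ) * θ₂
  θ₁-θ₂∣k+[v-1]θ₂ = θ₁-θ₂∣k+[n-1]θ₂ srg ε θ₁ θ₂ (proj₁ roots) (proj₂ roots)
  common-divisor∣k : ∀ d → d ∣ θ₁ → d ∣ θ₂ → d ∣ + k
  common-divisor∣k d d∣θ₁ d∣θ₂ = ∣⇒∣ᵤ {d} {+ k}
    (∣m+n∣n⇒∣m (∣-trans (∣m∣n⇒∣m-n d∣θ₁′ d∣θ₂′) θ₁-θ₂∣k+[v-1]θ₂) (∣n⇒∣m*n (+ v - 1ℤ) d∣θ₂′))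
    where
    d∣θ₁′ : d Signed.∣ θ₁
    d∣θ₁′ = ∣ᵤ⇒∣ d∣θ₁
    d∣θ₂′ : d Signed.∣ θ₂
    d∣θ₂′ = ∣ᵤ⇒∣ d∣θ₂
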